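{- Let $(X,\le)$ be a poset, $\alpha\colon X\to X$ an order automorphism of $(X,\le)$, and $\beta\colon X\to X$ a self-inverse dual order automorphism of $(X,\le)$ with $\beta=\alpha\circ\beta\circ\alpha$. Set $1={\le}$ and $0=\alpha\circ(\le^{c})^{\smile}=(\le^{c})^{\smile}\circ\alpha$, and for $R\in\mathsf{Up}((X^2,\preceq))$ define ${\sim}R=(R^{\smile}\circ 0^{c})^{c}$, ${ - }R=(0^{c}\circ R^{\smile})^{c}$ and $R'=\alpha\circ\beta\circ R^{c}\circ\beta$. Then $\mathbf{Dq}((X^2,\preceq))=\langle\mathsf{Up}((X^2,\preceq)),\cap,\cup,\circ,1,0,{\sim},{ - },'\rangle$ is a distributive quasi relation algebra.
   Context: Binary relations on $X$: $R\circ S=\{(x,y)\mid \exists z\,((x,z)\in R,(z,y)\in S)\}$, $R^{\smile}=\{(x,y)\mid (y,x)\in R\}$, $R^{c}=X^2\setminus R$. Functions $X\to X$ are identified with their graphs $\{(x,\gamma(x))\}$. Order automorphism: bijection with $x\le y\iff\alpha(x)\le\alpha(y)$; dual order automorphism: bijection with $x\le y\iff\beta(y)\le\beta(x)$; self-inverse: $\beta\circ\beta=\mathrm{id}_X$. $X^2$ is ordered by $(u,v)\preceq(x,y)$ iff $x\le u$ and $v\le y$; $\mathsf{Up}((X^2,\preceq))$ is its set of up-sets. A quasi relation algebra $\langle A,\wedge,\vee,\cdot,1,0,{\sim},{ - },'\rangle$: $\langle A,\wedge,\vee,\cdot,1\rangle$ is a lattice-ordered monoid which is residuated ($a\cdot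 b\le c\iff a\le c/b\iff b\le a\backslash c$), $0\in A$ arbitrary, ${\sim}a=a\backslash 0$, ${ - }a=0/a$, with ${\sim}{ - }a={ - }{\sim}a=a$; with $a+b={\sim}({ - }b\cdot{ - }a)$, the unary $'$ satisfies $a''=a$, $(a\vee b)'=a'\wedge b'$, $({\sim}a)'={ - }(a')$, $(a\cdot b)'=a'+b'$. Distributive means the lattice reduct is distributive. -}

module Defs where

open import Level using (Level; _⊔_) renaming (suc to lsuc)
open import Data.Product using (Σ; _×_; _,_)
open import Data.Sum using (_⊎_)
open import Relation.Nullary using (¬_)
open import Relation.Binary.PropositionalEquality using (_≡_)
open import Relation.Binary.Structures using (IsPartialOrder)
open import Function.Definitions using (Bijective)

-- Generic notion: a distributive quasi relation algebra, presented on the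
-- elements of a carrier A satisfying a predicate U (the "universe" of the
-- algebra), with equality a given relation _≈_.  The operations are given on
-- all of A; closure of U under them is part of the definition.

record IsDistribQRA {a u e : Level} {A : Set a} (U : A → Set u)
    (_≈_ : A → A → Set e)
    (_∧_ _∨_ _·_ : A → A → A) (𝟏 𝟎 : A) (∼_ -_ _′ : A → A)
    : Set (a ⊔ u ⊔ e) where
  infix 4 _≤_
  _≤_ : A → A → Set e
  x ≤ y = (x ∧ y) ≈ x
  _+_ : A → A → A
  x + y = ∼ ((- y) · (- x))
  field
    U-∧ : ∀ {x y} → U x → U y → U (x ∧ y)
    U-∨ : ∀ {x y} → U x → U y → U (x ∨ y)
    U-· : ∀ {x y} → U x → U y → U (x · y)
    U-𝟏 : U 𝟏
    U-𝟎 : U 𝟎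
    U-∼ : ∀ {x} → U x → U (∼ x)
    U-- : ∀ {x} → U x → U (- x)
    U-′ : ∀ {x} → U x → U (x ′)
    ≈-refl  : ∀ {x} → x ≈ x
    ≈-sym   : ∀ {x y} → x ≈ y → y ≈ x
    ≈-trans : ∀ {x y z} → x ≈ y → y ≈ z → x ≈ z
    ∧-cong : ∀ {x y z w} → x ≈ y → z ≈ w → (x ∧ z) ≈ (y ∧ w)
    ∨-cong : ∀ {x y z w} → x ≈ y → z ≈ w → (x ∨ z) ≈ (y ∨ w)
    ·-cong : ∀ {x y z w} → x ≈ y → z ≈ w → (x · z) ≈ (y · w)
    ∼-cong : ∀ {x y} → x ≈ y → (∼ x) ≈ (∼ y)
    ′-cong : ∀ {x y} → x ≈ y → (x ′) ≈ (y ′)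
    ∧-comm  : ∀ {x y} → U x → U y → (x ∧ y) ≈ (y ∧ x)
    ∨-comm  : ∀ {x y} → U x → U y → (x ∨ y) ≈ (y ∨ x)
    ∧-assoc : ∀ {x y z} → U x → U y → U z → ((x ∧ y) ∧ z) ≈ (x ∧ (y ∧ z))
    ∨-assoc : ∀ {x y z} → U x → U y → U z → ((x ∨ y) ∨ z) ≈ (x ∨ (y ∨ z))
    ∧-absorbs-∨ : ∀ {x y} → U x → U y → (x ∧ (x ∨ y)) ≈ x
    ∨-absorbs-∧ : ∀ {x y} → U x → U y → (x ∨ (x ∧ y)) ≈ x
    ∧-distrib-∨ : ∀ {x y z} → U x → U y → U z →
                  (x ∧ (y ∨ z)) ≈ ((x ∧ y) ∨ (x ∧ z))
    ·-assoc : ∀ {x y z} → U x → U y → U z → ((x · y) · z) ≈ (x · (y · z))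
    ·-identityˡ : ∀ {x} → U x → (𝟏 · x) ≈ x
    ·-identityʳ : ∀ {x} → U x → (x · 𝟏) ≈ x
    ·-monoˡ : ∀ {x y z} → U x → U y → U z → x ≤ y → (x · z) ≤ (y · z)
    ·-monoʳ : ∀ {x y z} → U x → U y → U z → x ≤ y → (z · x) ≤ (z · y)
    residuals : Σ (A → A → A) λ _/_ → Σ (A → A → A) λ _\\_ →
        (∀ {x y} → U x → U y → U (x / y))
      × (∀ {x y} → U x → U y → U (x \\ y))
      × (∀ {x y z} → U x → U y → U z →
           ((x · y ≤ z → x ≤ z / y) × (x ≤ z / y → x · y ≤ z))
         × ((x · y ≤ z → y ≤ x \\ z) × (y ≤ x \\ z → x · y ≤ z)))
      × (∀ {x} → U x → (∼ x) ≈ (x \\ 𝟎))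
      × (∀ {x} → U x → (- x) ≈ (𝟎 / x))
    ∼- : ∀ {x} → U x → (∼ (- x)) ≈ x
    -∼ : ∀ {x} → U x → (- (∼ x)) ≈ x
    ′′ : ∀ {x} → U x → ((x ′) ′) ≈ x
    ′-∨ : ∀ {x y} → U x → U y → ((x ∨ y) ′) ≈ ((x ′) ∧ (y ′))
    ′-∼ : ∀ {x} → U x → ((∼ x) ′) ≈ (- (x ′))
    ′-· : ∀ {x y} → U x → U y → ((x · y) ′) ≈ ((x ′) + (y ′))

module _ {ℓ : Level} {X : Set ℓ} where

  BRel : Set (lsuc ℓ)
  BRel = X → X → Set ℓ

  _⨾_ : BRel → BRel → BRel
  (R ⨾ S) x y = Σ X λ z → R x z × S z y

  _˘ : BRel → BRel
  (R ˘) x y = R y x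

  _ᶜ : BRel → BRel
  (R ᶜ) x y = ¬ R x y

  _∩_ : BRel → BRel → BRel
  (R ∩ S) x y = R x y × S x y

  _∪_ : BRel → BRel → BRel
  (R ∪ S) x y = R x y ⊎ S x y

  gr : (X → X) → BRel
  gr f x y = f x ≡ y

  _≐_ : BRel → BRel → Set ℓ
  R ≐ S = ∀ x y → (R x y → S x y) × (S x y → R x y)

  -- up-sets of (X², ⪯), where (u,v) ⪯ (x,y) iff x ≤ u and v ≤ y
  IsUpSet : (_≤_ : BRel) → BRel → Set ℓ
  IsUpSet _≤_ R = ∀ {u v x y} → x ≤ u → v ≤ y → R u v → R x y

  IsOrderAutomorphism : (_≤_ : BRel) → (X → X) → Set ℓ
  IsOrderAutomorphism _≤_ f = Bijective _≡_ _≡_ f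
    × (∀ x y → (x ≤ y → f x ≤ f y) × (f x ≤ f y → x ≤ y))

  IsDualOrderAutomorphism : (_≤_ : BRel) → (X → X) → Set ℓ
  IsDualOrderAutomorphism _≤_ f = Bijective _≡_ _≡_ f
    × (∀ x y → (x ≤ y → f y ≤ f x) × (f y ≤ f x → x ≤ y))

  module Dq (_≤_ : BRel) (α β : X → X) where
    one : BRel
    one = _≤_
    zero : BRel
    zero = gr α ⨾ ((_≤_ ᶜ) ˘)
    ∼ᵈ : BRel → BRel
    ∼ᵈ R = ((R ˘) ⨾ (zero ᶜ)) ᶜ
    -ᵈ : BRel → BRel
    -ᵈ R = ((zero ᶜ) ⨾ (R ˘)) ᶜ
    ′ᵈ : BRel → BRel
    ′ᵈ R = ((gr α ⨾ gr β) ⨾ (R ᶜ)) ⨾ gr β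

{-# OPTIONS --safe #-}
-- Pointwise, every operation of Dq negates a reindexing of its argument:
-- -R x y ⇔ ¬ R y (α x), ∼R x y ⇔ ¬ R (α⁻¹ y) x and R′ x y ⇔ ¬ R (βα x) (β y),
-- the first two because R is an up-set and 0ᶜ x y ⇔ y ≤ α x.  With excluded
-- middle each quasi relation algebra identity thus reduces to a double negation
-- plus one of α α⁻¹ = id, (βα)² = id, β² = id, α⁻¹ β = βα (the last two from
-- β = αβα).  The residuated lattice-ordered monoid part holds for the up-sets of
-- any preorder, with residuals T / S = (Tᶜ ∘ S˘)ᶜ and R \ T = (R˘ ∘ Tᶜ)ᶜ.
module Submission where

open import Defs
open import Level using (Level)
open import Relation.Binary.PropositionalEquality using (_≡_; refl; sym; trans; cong; subst; subst₂)
open import Relation.Binary.Structures using (IsPartialOrder; IsPreorder)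
open import Relation.Binary.Core using (_⇒_)
open import Relation.Binary.Definitions using (Monotonic₁; Antitonic₁)
open import Relation.Nullary using (¬_)
open import Axiom.ExcludedMiddle using (ExcludedMiddle)
open import Axiom.DoubleNegationElimination using (DoubleNegationElimination; em⇒dne)
open import Data.Product using (_×_; _,_; proj₁; proj₂)
open import Data.Sum using (inj₁; inj₂; [_,_])
open import Function using (id; _∘_)
open import Function.Bundles using (Inverse; mk⤖)
open import Function.Properties.Bijection using (⤖⇒↔)

module _ {ℓ : Level} (dne : DoubleNegationElimination ℓ) {A B : Set ℓ} where

  ¬-swap : (A → ¬ B) → (¬ B → A) → (¬ A → B) × (B → ¬ A)
  ¬-swap A⇒¬B ¬B⇒A = (λ ¬a → dne (¬a ∘ ¬B⇒A)) , (λ b a → A⇒¬B a b)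

module Relations {ℓ : Level} {X : Set ℓ} where

  private variable
    R S T R′ S′ : BRel {X = X}

  _/_ : BRel {X = X} → BRel → BRel
  T / S = ((T ᶜ) ⨾ (S ˘)) ᶜ

  _\\_ : BRel {X = X} → BRel → BRel
  R \\ T = ((R ˘) ⨾ (T ᶜ)) ᶜ

  ≐-refl : R ≐ R
  ≐-refl x y = id , id

  ≐-sym : R ≐ S → S ≐ R
  ≐-sym e x y = proj₂ (e x y) , proj₁ (e x y)

  ≐-trans : R ≐ S → S ≐ T → R ≐ T
  ≐-trans e e′ x y = proj₁ (e′ x y) ∘ proj₁ (e x y) , proj₂ (e x y) ∘ proj₂ (e′ x y)

  ⇒-antisym : R ⇒ S → S ⇒ R → R ≐ S
  ⇒-antisym R⇒S S⇒R x y = R⇒S , S⇒R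

  ⇒⇒∩≐ : R ⇒ S → (R ∩ S) ≐ R
  ⇒⇒∩≐ R⇒S = ⇒-antisym proj₁ (λ r → r , R⇒S r)

  ∩≐⇒⇒ : (R ∩ S) ≐ R → R ⇒ S
  ∩≐⇒⇒ e {x} {y} = proj₂ ∘ proj₂ (e x y)

  ∩-cong : R ≐ R′ → S ≐ S′ → (R ∩ S) ≐ (R′ ∩ S′)
  ∩-cong e e′ x y = (λ (r , s) → proj₁ (e x y) r , proj₁ (e′ x y) s)
                  , (λ (r , s) → proj₂ (e x y) r , proj₂ (e′ x y) s)

  ∪-cong : R ≐ R′ → S ≐ S′ → (R ∪ S) ≐ (R′ ∪ S′)
  ∪-cong e e′ x y = (λ { (inj₁ r) → inj₁ (proj₁ (e x y) r) ; (inj₂ s) → inj₂ (proj₁ (e′ x y) s) })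
                  , (λ { (inj₁ r) → inj₁ (proj₂ (e x y) r) ; (inj₂ s) → inj₂ (proj₂ (e′ x y) s) })

  ⨾-cong : R ≐ R′ → S ≐ S′ → (R ⨾ S) ≐ (R′ ⨾ S′)
  ⨾-cong e e′ x y = (λ (z , r , s) → z , proj₁ (e x z) r , proj₁ (e′ z y) s)
                  , (λ (z , r , s) → z , proj₂ (e x z) r , proj₂ (e′ z y) s)

  ᶜ-cong : R ≐ S → (R ᶜ) ≐ (S ᶜ)
  ᶜ-cong e x y = (λ ¬r s → ¬r (proj₂ (e x y) s)) , (λ ¬s r → ¬s (proj₁ (e x y) r))

  ˘-cong : R ≐ S → (R ˘) ≐ (S ˘)
  ˘-cong e x y = e y x

  ∩-comm : (R ∩ S) ≐ (S ∩ R)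
  ∩-comm = ⇒-antisym (λ (r , s) → s , r) (λ (s , r) → r , s)

  ∪-comm : (R ∪ S) ≐ (S ∪ R)
  ∪-comm {R = R} {S = S} = ⇒-antisym (swap {R} {S}) (swap {S} {R})
    where
    swap : ∀ {R S : BRel {X = X}} → (R ∪ S) ⇒ (S ∪ R)
    swap (inj₁ r) = inj₂ r
    swap (inj₂ s) = inj₁ s

  ∩-assoc : ((R ∩ S) ∩ T) ≐ (R ∩ (S ∩ T))
  ∩-assoc = ⇒-antisym (λ ((r , s) , t) → r , s , t) (λ (r , s , t) → (r , s) , t)

  ∪-assoc : ((R ∪ S) ∪ T) ≐ (R ∪ (S ∪ T))
  ∪-assoc = ⇒-antisym
    (λ { (inj₁ (inj₁ r)) → inj₁ r ; (inj₁ (inj₂ s)) → inj₂ (inj₁ s) ; (inj₂ t) → inj₂ (inj₂ t) })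
    (λ { (inj₁ r) → inj₁ (inj₁ r) ; (inj₂ (inj₁ s)) → inj₁ (inj₂ s) ; (inj₂ (inj₂ t)) → inj₂ t })

  ∩-absorbs-∪ : (R ∩ (R ∪ S)) ≐ R
  ∩-absorbs-∪ = ⇒-antisym proj₁ (λ r → r , inj₁ r)

  ∪-absorbs-∩ : (R ∪ (R ∩ S)) ≐ R
  ∪-absorbs-∩ = ⇒-antisym (λ { (inj₁ r) → r ; (inj₂ (r , _)) → r }) inj₁

  ∩-distribˡ-∪ : (R ∩ (S ∪ T)) ≐ ((R ∩ S) ∪ (R ∩ T))
  ∩-distribˡ-∪ = ⇒-antisym
    (λ { (r , inj₁ s) → inj₁ (r , s) ; (r , inj₂ t) → inj₂ (r , t) })
    (λ { (inj₁ (r , s)) → r , inj₁ s ; (inj₂ (r , t)) → r , inj₂ t })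

  ⨾-assoc : ((R ⨾ S) ⨾ T) ≐ (R ⨾ (S ⨾ T))
  ⨾-assoc = ⇒-antisym (λ (w , (z , r , s) , t) → z , r , w , s , t)
                      (λ (z , r , w , s , t) → w , (z , r , s) , t)

  ⨾-monoˡ : R ⇒ S → (R ⨾ T) ⇒ (S ⨾ T)
  ⨾-monoˡ R⇒S (z , r , t) = z , R⇒S r , t

  ⨾-monoʳ : R ⇒ S → (T ⨾ R) ⇒ (T ⨾ S)
  ⨾-monoʳ R⇒S (z , t , r) = z , t , R⇒S r

  ⨾⇒⇒⇒/ : (R ⨾ S) ⇒ T → R ⇒ (T / S)
  ⨾⇒⇒⇒/ R⨾S⇒T r (z , ¬t , s) = ¬t (R⨾S⇒T (_ , r , s))

  ⇒/⇒⨾⇒ : DoubleNegationElimination ℓ → R ⇒ (T / S) → (R ⨾ S) ⇒ T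
  ⇒/⇒⨾⇒ dne R⇒T/S (z , r , s) = dne λ ¬t → R⇒T/S r (_ , ¬t , s)

  ⨾⇒⇒⇒\\ : (R ⨾ S) ⇒ T → S ⇒ (R \\ T)
  ⨾⇒⇒⇒\\ R⨾S⇒T s (z , r , ¬t) = ¬t (R⨾S⇒T (_ , r , s))

  ⇒\\⇒⨾⇒ : DoubleNegationElimination ℓ → S ⇒ (R \\ T) → (R ⨾ S) ⇒ T
  ⇒\\⇒⨾⇒ dne S⇒R\\T (z , r , s) = dne λ ¬t → S⇒R\\T s (_ , r , ¬t)

module UpSets {ℓ : Level} {X : Set ℓ} (_≤_ : BRel {X = X}) (≤-isPreorder : IsPreorder _≡_ _≤_) where

  open Relations
  open IsPreorder ≤-isPreorder using () renaming (refl to ≤-refl; trans to ≤-trans)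

  private variable
    R S : BRel {X = X}
    f g : X → X

  isUpSet-resp-≐ : R ≐ S → IsUpSet _≤_ R → IsUpSet _≤_ S
  isUpSet-resp-≐ e R↑ x≤u v≤y s = proj₁ (e _ _) (R↑ x≤u v≤y (proj₂ (e _ _) s))

  ∩-isUpSet : IsUpSet _≤_ R → IsUpSet _≤_ S → IsUpSet _≤_ (R ∩ S)
  ∩-isUpSet R↑ S↑ x≤u v≤y (r , s) = R↑ x≤u v≤y r , S↑ x≤u v≤y s

  ∪-isUpSet : IsUpSet _≤_ R → IsUpSet _≤_ S → IsUpSet _≤_ (R ∪ S)
  ∪-isUpSet R↑ S↑ x≤u v≤y (inj₁ r) = inj₁ (R↑ x≤u v≤y r)
  ∪-isUpSet R↑ S↑ x≤u v≤y (inj₂ s) = inj₂ (S↑ x≤u v≤y s)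

  ⨾-isUpSet : IsUpSet _≤_ R → IsUpSet _≤_ S → IsUpSet _≤_ (R ⨾ S)
  ⨾-isUpSet R↑ S↑ x≤u v≤y (z , r , s) = z , R↑ x≤u ≤-refl r , S↑ ≤-refl v≤y s

  ≤-isUpSet : IsUpSet _≤_ _≤_
  ≤-isUpSet x≤u v≤y u≤v = ≤-trans x≤u (≤-trans u≤v v≤y)

  /-isUpSet : IsUpSet _≤_ R → IsUpSet _≤_ S → IsUpSet _≤_ (R / S)
  /-isUpSet R↑ S↑ x≤u v≤y r/s (z , ¬r , s) = r/s (z , ¬r ∘ R↑ x≤u ≤-refl , S↑ v≤y ≤-refl s)

  \\-isUpSet : IsUpSet _≤_ R → IsUpSet _≤_ S → IsUpSet _≤_ (R \\ S)
  \\-isUpSet R↑ S↑ x≤u v≤y r\\s (z , r , ¬s) = r\\s (z , R↑ ≤-refl x≤u r , ¬s ∘ S↑ ≤-refl v≤y)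

  ¬-antitone-isUpSet : Antitonic₁ _≤_ _≤_ f → Antitonic₁ _≤_ _≤_ g →
                       IsUpSet _≤_ R → IsUpSet _≤_ (λ x y → ¬ R (f x) (g y))
  ¬-antitone-isUpSet f-anti g-anti R↑ x≤u v≤y ¬r r = ¬r (R↑ (f-anti x≤u) (g-anti v≤y) r)

  ≤-⨾-identity : IsUpSet _≤_ R → (_≤_ ⨾ R) ≐ R
  ≤-⨾-identity R↑ = ⇒-antisym (λ (_ , x≤z , r) → R↑ x≤z ≤-refl r) (λ r → _ , ≤-refl , r)

  ⨾-≤-identity : IsUpSet _≤_ R → (R ⨾ _≤_) ≐ R
  ⨾-≤-identity R↑ = ⇒-antisym (λ (_ , r , z≤y) → R↑ ≤-refl z≤y r) (λ r → _ , r , ≤-refl)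

module DqProperties {ℓ : Level} {X : Set ℓ} (dne : DoubleNegationElimination ℓ)
    (_≤_ : BRel {X = X}) (≤-isPreorder : IsPreorder _≡_ _≤_)
    (α β : X → X) (α-isOrderAutomorphism : IsOrderAutomorphism _≤_ α)
    (β-antitone : Antitonic₁ _≤_ _≤_ β) (β-involutive : ∀ x → β (β x) ≡ x)
    (β≡αβα : ∀ x → β x ≡ α (β (α x))) where

  open Relations
  open UpSets _≤_ ≤-isPreorder
  open Dq _≤_ α β
  open IsPreorder ≤-isPreorder using ()
    renaming (refl to ≤-refl; trans to ≤-trans; reflexive to ≤-reflexive)
  open Inverse (⤖⇒↔ (mk⤖ (proj₁ α-isOrderAutomorphism))) using ()
    renaming (from to α⁻¹; strictlyInverseˡ to α∘α⁻¹≗id; strictlyInverseʳ to α⁻¹∘α≗id)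

  private variable
    R S : BRel {X = X}

  α-monotone : Monotonic₁ _≤_ _≤_ α
  α-monotone {x} {y} = proj₁ (proj₂ α-isOrderAutomorphism x y)

  ≤α⇒α⁻¹≤ : ∀ {x y} → y ≤ α x → α⁻¹ y ≤ x
  ≤α⇒α⁻¹≤ {x} {y} y≤αx =
    proj₂ (proj₂ α-isOrderAutomorphism (α⁻¹ y) x) (subst (_≤ α x) (sym (α∘α⁻¹≗id y)) y≤αx)

  βα-antitone : Antitonic₁ _≤_ _≤_ (β ∘ α)
  βα-antitone = β-antitone ∘ α-monotone

  βα-involutive : ∀ x → β (α (β (α x))) ≡ x
  βα-involutive x = proj₁ (proj₁ α-isOrderAutomorphism)
    (trans (sym (β≡αβα (β (α x)))) (β-involutive (α x)))

  α⁻¹β≗βα : ∀ x → α⁻¹ (β x) ≡ β (α x)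
  α⁻¹β≗βα x = trans (cong α⁻¹ (β≡αβα x)) (α⁻¹∘α≗id (β (α x)))

  zero-isUpSet : IsUpSet _≤_ zero
  zero-isUpSet x≤u v≤y (_ , refl , v≰αu) =
    _ , refl , λ y≤αx → v≰αu (≤-trans v≤y (≤-trans y≤αx (α-monotone x≤u)))

  zeroᶜ≐ : (zero ᶜ) ≐ λ x y → y ≤ α x
  zeroᶜ≐ x y = (λ ¬zero → dne λ y≰αx → ¬zero (α x , refl , y≰αx))
             , (λ { y≤αx (_ , refl , y≰αx) → y≰αx y≤αx })

  -ᵈ≐ : IsUpSet _≤_ R → -ᵈ R ≐ λ x y → ¬ R y (α x)
  -ᵈ≐ R↑ x y = (λ -r r → -r (α x , proj₂ (zeroᶜ≐ x (α x)) ≤-refl , r))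
             , (λ { ¬r (z , ¬zero , r) → ¬r (R↑ ≤-refl (proj₁ (zeroᶜ≐ x z) ¬zero) r) })

  ∼ᵈ≐ : IsUpSet _≤_ R → ∼ᵈ R ≐ λ x y → ¬ R (α⁻¹ y) x
  ∼ᵈ≐ R↑ x y =
      (λ ∼r r → ∼r (α⁻¹ y , r , proj₂ (zeroᶜ≐ (α⁻¹ y) y) (≤-reflexive (sym (α∘α⁻¹≗id y)))))
    , (λ { ¬r (z , r , ¬zero) → ¬r (R↑ (≤α⇒α⁻¹≤ (proj₁ (zeroᶜ≐ z y) ¬zero)) ≤-refl r) })

  ′ᵈ≐ : ′ᵈ R ≐ λ x y → ¬ R (β (α x)) (β y)
  ′ᵈ≐ {R = R} x y =
      (λ { (w , (_ , (_ , refl , refl) , ¬r) , refl) r → ¬r (subst (R _) (β-involutive w) r) })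
    , (λ ¬r → β y , (β (α x) , (α x , refl , refl) , ¬r) , β-involutive y)

  ∼ᵈ-isUpSet : IsUpSet _≤_ R → IsUpSet _≤_ (∼ᵈ R)
  ∼ᵈ-isUpSet R↑ = \\-isUpSet R↑ zero-isUpSet

  -ᵈ-isUpSet : IsUpSet _≤_ R → IsUpSet _≤_ (-ᵈ R)
  -ᵈ-isUpSet R↑ = /-isUpSet zero-isUpSet R↑

  ′ᵈ-isUpSet : IsUpSet _≤_ R → IsUpSet _≤_ (′ᵈ R)
  ′ᵈ-isUpSet R↑ = isUpSet-resp-≐ (≐-sym ′ᵈ≐) (¬-antitone-isUpSet βα-antitone β-antitone R↑)

  ∼ᵈ-cong : R ≐ S → ∼ᵈ R ≐ ∼ᵈ S
  ∼ᵈ-cong e = ᶜ-cong (⨾-cong (˘-cong e) ≐-refl)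

  ′ᵈ-cong : R ≐ S → ′ᵈ R ≐ ′ᵈ S
  ′ᵈ-cong e = ⨾-cong (⨾-cong ≐-refl (ᶜ-cong e)) ≐-refl

  ∼ᵈ-ᵈ : IsUpSet _≤_ R → ∼ᵈ (-ᵈ R) ≐ R
  ∼ᵈ-ᵈ {R = R} R↑ = ≐-trans (∼ᵈ≐ (-ᵈ-isUpSet R↑)) λ x y → ¬-swap dne
    (λ -r → proj₁ (-ᵈ≐ R↑ _ _) -r ∘ subst (R x) (sym (α∘α⁻¹≗id y)))
    (λ ¬r → proj₂ (-ᵈ≐ R↑ _ _) (¬r ∘ subst (R x) (α∘α⁻¹≗id y)))

  -ᵈ-∼ᵈ : IsUpSet _≤_ R → -ᵈ (∼ᵈ R) ≐ R
  -ᵈ-∼ᵈ {R = R} R↑ = ≐-trans (-ᵈ≐ (∼ᵈ-isUpSet R↑)) λ x y → ¬-swap dne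
    (λ ∼r → proj₁ (∼ᵈ≐ R↑ _ _) ∼r ∘ subst (λ t → R t y) (sym (α⁻¹∘α≗id x)))
    (λ ¬r → proj₂ (∼ᵈ≐ R↑ _ _) (¬r ∘ subst (λ t → R t y) (α⁻¹∘α≗id x)))

  ′ᵈ-involutive : ′ᵈ (′ᵈ R) ≐ R
  ′ᵈ-involutive {R = R} = ≐-trans ′ᵈ≐ λ x y → ¬-swap dne
    (λ ′r → proj₁ (′ᵈ≐ _ _) ′r ∘ subst₂ R (sym (βα-involutive x)) (sym (β-involutive y)))
    (λ ¬r → proj₂ (′ᵈ≐ _ _) (¬r ∘ subst₂ R (βα-involutive x) (β-involutive y)))

  ′ᵈ-∪ : ′ᵈ (R ∪ S) ≐ (′ᵈ R ∩ ′ᵈ S)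
  ′ᵈ-∪ {R = R} {S = S} = ≐-trans ′ᵈ≐ (≐-trans deMorgan (≐-sym (∩-cong ′ᵈ≐ ′ᵈ≐)))
    where
    deMorgan : (λ x y → ¬ (R ∪ S) (β (α x)) (β y))
             ≐ ((λ x y → ¬ R (β (α x)) (β y)) ∩ (λ x y → ¬ S (β (α x)) (β y)))
    deMorgan x y = (λ ¬r∪s → ¬r∪s ∘ inj₁ , ¬r∪s ∘ inj₂) , λ (¬r , ¬s) → [ ¬r , ¬s ]

  -ᵈ′ᵈ≐ : IsUpSet _≤_ R → -ᵈ (′ᵈ R) ≐ λ x y → R (β (α y)) (β (α x))
  -ᵈ′ᵈ≐ R↑ = ≐-trans (-ᵈ≐ (′ᵈ-isUpSet R↑)) λ x y → ¬-swap dne (proj₁ (′ᵈ≐ _ _)) (proj₂ (′ᵈ≐ _ _))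

  ′ᵈ-∼ᵈ : IsUpSet _≤_ R → ′ᵈ (∼ᵈ R) ≐ -ᵈ (′ᵈ R)
  ′ᵈ-∼ᵈ {R = R} R↑ = ≐-trans ′ᵈ≐ (≐-trans ¬∼ᵈ≐ (≐-sym (-ᵈ′ᵈ≐ R↑)))
    where
    ¬∼ᵈ≐ : (λ x y → ¬ ∼ᵈ R (β (α x)) (β y)) ≐ λ x y → R (β (α y)) (β (α x))
    ¬∼ᵈ≐ x y = ¬-swap dne
      (λ ∼r → proj₁ (∼ᵈ≐ R↑ _ _) ∼r ∘ subst (λ t → R t _) (sym (α⁻¹β≗βα y)))
      (λ ¬r → proj₂ (∼ᵈ≐ R↑ _ _) (¬r ∘ subst (λ t → R t _) (α⁻¹β≗βα y)))

  -ᵈ′ᵈ-⨾-˘≐ : IsUpSet _≤_ R → IsUpSet _≤_ S →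
              ((-ᵈ (′ᵈ S) ⨾ -ᵈ (′ᵈ R)) ˘) ≐ λ x y → (R ⨾ S) (β (α x)) (β (α y))
  -ᵈ′ᵈ-⨾-˘≐ {R = R} {S = S} R↑ S↑ x y =
      (λ (z , s , r) → β (α z) , proj₁ (-ᵈ′ᵈ≐ R↑ z x) r , proj₁ (-ᵈ′ᵈ≐ S↑ y z) s)
    , (λ (w , r , s) → β (α w)
        , proj₂ (-ᵈ′ᵈ≐ S↑ y _) (subst (λ t → S t _) (sym (βα-involutive w)) s)
        , proj₂ (-ᵈ′ᵈ≐ R↑ _ x) (subst (R _) (sym (βα-involutive w)) r))

  ′ᵈ-⨾ : IsUpSet _≤_ R → IsUpSet _≤_ S → ′ᵈ (R ⨾ S) ≐ ∼ᵈ (-ᵈ (′ᵈ S) ⨾ -ᵈ (′ᵈ R))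
  ′ᵈ-⨾ {R = R} {S = S} R↑ S↑ = ≐-trans ′ᵈ≐ (≐-trans (ᶜ-cong ⨾≐) (≐-sym (∼ᵈ≐ Q↑)))
    where
    Q↑ : IsUpSet _≤_ (-ᵈ (′ᵈ S) ⨾ -ᵈ (′ᵈ R))
    Q↑ = ⨾-isUpSet (-ᵈ-isUpSet (′ᵈ-isUpSet S↑)) (-ᵈ-isUpSet (′ᵈ-isUpSet R↑))
    ⨾≐ : (λ x y → (R ⨾ S) (β (α x)) (β y)) ≐ λ x y → (-ᵈ (′ᵈ S) ⨾ -ᵈ (′ᵈ R)) (α⁻¹ y) x
    ⨾≐ x y = proj₂ (-ᵈ′ᵈ-⨾-˘≐ R↑ S↑ x (α⁻¹ y)) ∘ subst P β≡βαα⁻¹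
           , subst P (sym β≡βαα⁻¹) ∘ proj₁ (-ᵈ′ᵈ-⨾-˘≐ R↑ S↑ x (α⁻¹ y))
      where
      P : X → Set ℓ
      P = (R ⨾ S) (β (α x))
      β≡βαα⁻¹ : β y ≡ β (α (α⁻¹ y))
      β≡βαα⁻¹ = cong β (sym (α∘α⁻¹≗id y))

corollary3p16 : {ℓ : Level} → ExcludedMiddle ℓ →
    (X : Set ℓ) (_≤_ : X → X → Set ℓ) → IsPartialOrder _≡_ _≤_ →
    (α β : X → X) → IsOrderAutomorphism _≤_ α →
    IsDualOrderAutomorphism _≤_ β → (∀ x → β (β x) ≡ x) →
    (∀ x → β x ≡ α (β (α x))) →
    IsDistribQRA (IsUpSet _≤_) _≐_ _∩_ _∪_ _⨾_
      (Dq.one _≤_ α β) (Dq.zero _≤_ α β)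
      (Dq.∼ᵈ _≤_ α β) (Dq.-ᵈ _≤_ α β) (Dq.′ᵈ _≤_ α β)
corollary3p16 em X _≤_ ≤-isPartialOrder α β α-isOrderAutomorphism β-isDualOrderAutomorphism
  β-involutive β≡αβα = record
  { U-∧ = ∩-isUpSet ; U-∨ = ∪-isUpSet ; U-· = ⨾-isUpSet ; U-𝟏 = ≤-isUpSet ; U-𝟎 = zero-isUpSet
  ; U-∼ = ∼ᵈ-isUpSet ; U-- = -ᵈ-isUpSet ; U-′ = ′ᵈ-isUpSet
  ; ≈-refl = ≐-refl ; ≈-sym = ≐-sym ; ≈-trans = ≐-trans
  ; ∧-cong = ∩-cong ; ∨-cong = ∪-cong ; ·-cong = ⨾-cong
  ; ∼-cong = ∼ᵈ-cong ; ′-cong = ′ᵈ-cong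
  ; ∧-comm = λ _ _ → ∩-comm ; ∨-comm = λ _ _ → ∪-comm
  ; ∧-assoc = λ _ _ _ → ∩-assoc ; ∨-assoc = λ _ _ _ → ∪-assoc
  ; ∧-absorbs-∨ = λ _ _ → ∩-absorbs-∪ ; ∨-absorbs-∧ = λ _ _ → ∪-absorbs-∩
  ; ∧-distrib-∨ = λ _ _ _ → ∩-distribˡ-∪
  ; ·-assoc = λ _ _ _ → ⨾-assoc ; ·-identityˡ = ≤-⨾-identity ; ·-identityʳ = ⨾-≤-identity
  ; ·-monoˡ = λ _ _ _ → ⇒⇒∩≐ ∘ ⨾-monoˡ ∘ ∩≐⇒⇒
  ; ·-monoʳ = λ _ _ _ → ⇒⇒∩≐ ∘ ⨾-monoʳ ∘ ∩≐⇒⇒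
  ; residuals = _/_ , _\\_ , /-isUpSet , \\-isUpSet
      , (λ _ _ _ → (⇒⇒∩≐ ∘ ⨾⇒⇒⇒/ ∘ ∩≐⇒⇒ , ⇒⇒∩≐ ∘ ⇒/⇒⨾⇒ dne ∘ ∩≐⇒⇒)
                 , (⇒⇒∩≐ ∘ ⨾⇒⇒⇒\\ ∘ ∩≐⇒⇒ , ⇒⇒∩≐ ∘ ⇒\\⇒⨾⇒ dne ∘ ∩≐⇒⇒))
      , (λ _ → ≐-refl) , (λ _ → ≐-refl)
  ; ∼- = ∼ᵈ-ᵈ ; -∼ = -ᵈ-∼ᵈ ; ′′ = λ _ → ′ᵈ-involutive ; ′-∨ = λ _ _ → ′ᵈ-∪
  ; ′-∼ = ′ᵈ-∼ᵈ ; ′-· = ′ᵈ-⨾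
  }
  where
  dne : DoubleNegationElimination _
  dne = em⇒dne em

  β-antitone : Antitonic₁ _≤_ _≤_ β
  β-antitone {x} {y} = proj₁ (proj₂ β-isDualOrderAutomorphism y x)

  open Relations
  open UpSets _≤_ (IsPartialOrder.isPreorder ≤-isPartialOrder)
  open DqProperties dne _≤_ (IsPartialOrder.isPreorder ≤-isPartialOrder)
    α β α-isOrderAutomorphism β-antitone β-involutive β≡αβα
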